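{- Let $\mathbb{F}$ be a field and let $\mathcal{A}\leq\Lambda(n,\mathbb{F})$ be a bipartite alternating matrix space. Let $T\in\mathrm{GL}(n,\mathbb{F})$ and positive integers $s,t$ with $s+t=n$ be such that every matrix in $T^t\mathcal{A}T=\{T^tAT: A\in\mathcal{A}\}$ has the block form $\begin{bmatrix}\mathbf{0} & B\\ -B^t & \mathbf{0}\end{bmatrix}$ with $B\in\mathrm{M}(s\times t,\mathbb{F})$ (the zero blocks being $s\times s$ and $t\times t$), and let $\mathcal{B}\leq\mathrm{M}(s\times t,\mathbb{F})$ be the space of all such $B$ arising from matrices in $T^t\mathcal{A}T$. Then $\alpha(\mathcal{A})=n-\mathrm{ncrk}(\mathcal{B})$.
   Context: $\Lambda(n,\mathbb{F})$ is the space of $n\times n$ alternating matrices over $\mathbb{F}$ ($v^tAv=0$ for all $v$). A subspace $U\leq\mathbb{F}^n$ is an isotropic space of $\mathcal{A}$ if $u^tAu'=0$ for all $u,u'\in U$, $A\in\mathcal{A}$; $\alpha(\mathcal{A})$ is the maximum dimension of an isotropic space. $\mathcal{A}$ is bipartite if $\mathbb{F}^n=U_1\oplus U_2$ with $U_1,U_2$ nonzero isotropic spaces. For $\mathcal{B}\leq\mathrm{M}(s\times t,\mathbb{F})$, the non-commutative rank is $\mathrm{ncrk}(\mathcal{B})=s+t-\max\{\dim U+\dim V : U\leq\mathbb{F}^s, V\leq\mathbb{F}^t, u^tBv=0\ \forall u\in U, v\in V, B\in\mathcal{B}\}$. -}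

module Defs where

open import Level using (Level; _⊔_) renaming (suc to lsuc)
open import Data.Nat using (ℕ; zero; suc) renaming (_+_ to _+ℕ_; _∸_ to _∸ℕ_; _≤_ to _≤ℕ_)
open import Data.Fin using (Fin; _↑ˡ_; _↑ʳ_) renaming (zero to fzero; suc to fsuc)
import Data.Fin as Fin
open import Data.Product using (Σ; _×_; _,_; ∃)
open import Relation.Nullary using (¬_; yes; no)
open import Relation.Binary.PropositionalEquality using (_≡_)
open import Algebra.Bundles using (CommutativeRing)

record Field (c ℓ : Level) : Set (lsuc (c ⊔ ℓ)) where
  field
    commutativeRing : CommutativeRing c ℓ
  open CommutativeRing commutativeRing public
  field
    0≉1     : ¬ (0# ≈ 1#)
    inverse : ∀ x → ¬ (x ≈ 0#) → Σ Carrier λ y → x * y ≈ 1#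

module LinAlg {c ℓ} (F : Field c ℓ) where
  open Field F
  infix 4 _≈ᵥ_ _≈ₘ_

  ∑ : ∀ {n} → (Fin n → Carrier) → Carrier
  ∑ {zero}  f = 0#
  ∑ {suc n} f = f fzero + ∑ (λ i → f (fsuc i))

  Vec : ℕ → Set c
  Vec n = Fin n → Carrier

  Mat : ℕ → ℕ → Set c
  Mat m n = Fin m → Fin n → Carrier

  _≈ᵥ_ : ∀ {n} → Vec n → Vec n → Set ℓ
  u ≈ᵥ v = ∀ i → u i ≈ v i

  0ᵥ : ∀ {n} → Vec n
  0ᵥ i = 0#

  _+ᵥ_ : ∀ {n} → Vec n → Vec n → Vec n
  (u +ᵥ v) i = u i + v i

  _·ᵥ_ : ∀ {n} → Carrier → Vec n → Vec n
  (a ·ᵥ v) i = a * v i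

  _≈ₘ_ : ∀ {m n} → Mat m n → Mat m n → Set ℓ
  A ≈ₘ B = ∀ i j → A i j ≈ B i j

  0ₘ : ∀ {m n} → Mat m n
  0ₘ i j = 0#

  _+ₘ_ : ∀ {m n} → Mat m n → Mat m n → Mat m n
  (A +ₘ B) i j = A i j + B i j

  _·ₘ_ : ∀ {m n} → Carrier → Mat m n → Mat m n
  (a ·ₘ A) i j = a * A i j

  _⊗_ : ∀ {m k n} → Mat m k → Mat k n → Mat m n
  (A ⊗ B) i j = ∑ λ l → A i l * B l j

  _ᵀ : ∀ {m n} → Mat m n → Mat n m
  (A ᵀ) i j = A j i

  I : ∀ {n} → Mat n n
  I i j with i Fin.≟ j
  ... | yes _ = 1#
  ... | no  _ = 0#

  form : ∀ {m n} → Vec m → Mat m n → Vec n → Carrier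
  form u A v = ∑ λ i → ∑ λ j → (u i * A i j) * v j

  Invertible : ∀ {n} → Mat n n → Set (c ⊔ ℓ)
  Invertible T = Σ (Mat _ _) λ T' → (T ⊗ T') ≈ₘ I × (T' ⊗ T) ≈ₘ I

  Alternating : ∀ {n} → Mat n n → Set (c ⊔ ℓ)
  Alternating A = ∀ v → form v A v ≈ 0#

  record IsSubspaceᵥ {n} (U : Vec n → Set (c ⊔ ℓ)) : Set (c ⊔ ℓ) where
    field
      resp : ∀ {u v} → u ≈ᵥ v → U u → U v
      zero∈ : U 0ᵥ
      +∈    : ∀ {u v} → U u → U v → U (u +ᵥ v)
      ·∈    : ∀ a {u} → U u → U (a ·ᵥ u)

  record IsSubspaceₘ {m n} (𝒜 : Mat m n → Set (c ⊔ ℓ)) : Set (c ⊔ ℓ) where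
    field
      resp : ∀ {A B} → A ≈ₘ B → 𝒜 A → 𝒜 B
      zero∈ : 𝒜 0ₘ
      +∈    : ∀ {A B} → 𝒜 A → 𝒜 B → 𝒜 (A +ₘ B)
      ·∈    : ∀ a {A} → 𝒜 A → 𝒜 (a ·ₘ A)

  lincomb : ∀ {d n} → (Fin d → Carrier) → (Fin d → Vec n) → Vec n
  lincomb co b i = ∑ λ k → co k * b k i

  HasDim : ∀ {n} → (Vec n → Set (c ⊔ ℓ)) → ℕ → Set (c ⊔ ℓ)
  HasDim {n} U d = Σ (Fin d → Vec n) λ b →
      (∀ k → U (b k))
    × (∀ co → lincomb co b ≈ᵥ 0ᵥ → ∀ k → co k ≈ 0#)
    × (∀ v → U v → Σ (Fin d → Carrier) λ co → v ≈ᵥ lincomb co b)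

  Isotropic : ∀ {n} → (Mat n n → Set (c ⊔ ℓ)) → (Vec n → Set (c ⊔ ℓ)) → Set (c ⊔ ℓ)
  Isotropic 𝒜 U = IsSubspaceᵥ U × (∀ u u' A → U u → U u' → 𝒜 A → form u A u' ≈ 0#)

  IsAlpha : ∀ {n} → (Mat n n → Set (c ⊔ ℓ)) → ℕ → Set (lsuc (c ⊔ ℓ))
  IsAlpha {n} 𝒜 a =
      (Σ (Vec n → Set (c ⊔ ℓ)) λ U → Isotropic 𝒜 U × HasDim U a)
    × (∀ U d → Isotropic 𝒜 U → HasDim U d → d ≤ℕ a)

  NonzeroSp : ∀ {n} → (Vec n → Set (c ⊔ ℓ)) → Set (c ⊔ ℓ)
  NonzeroSp U = Σ (Vec _) λ u → U u × ¬ (u ≈ᵥ 0ᵥ)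

  DirectSum : ∀ {n} → (Vec n → Set (c ⊔ ℓ)) → (Vec n → Set (c ⊔ ℓ)) → Set (c ⊔ ℓ)
  DirectSum {n} U₁ U₂ =
      (∀ v → Σ (Vec n) λ u₁ → Σ (Vec n) λ u₂ → U₁ u₁ × U₂ u₂ × v ≈ᵥ (u₁ +ᵥ u₂))
    × (∀ w → U₁ w → U₂ w → w ≈ᵥ 0ᵥ)

  Bipartite : ∀ {n} → (Mat n n → Set (c ⊔ ℓ)) → Set (lsuc (c ⊔ ℓ))
  Bipartite {n} 𝒜 = Σ (Vec n → Set (c ⊔ ℓ)) λ U₁ → Σ (Vec n → Set (c ⊔ ℓ)) λ U₂ →
    Isotropic 𝒜 U₁ × Isotropic 𝒜 U₂ × NonzeroSp U₁ × NonzeroSp U₂ × DirectSum U₁ U₂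

  congr : ∀ {n} → Mat n n → Mat n n → Mat n n
  congr T A = ((T ᵀ) ⊗ A) ⊗ T

  BlockForm : ∀ s t → (Mat (s +ℕ t) (s +ℕ t) → Set (c ⊔ ℓ)) → Mat (s +ℕ t) (s +ℕ t) → Set (c ⊔ ℓ)
  BlockForm s t 𝒜 T = ∀ A → 𝒜 A →
      (∀ (i j : Fin s) → congr T A (i ↑ˡ t) (j ↑ˡ t) ≈ 0#)
    × (∀ (i j : Fin t) → congr T A (s ↑ʳ i) (s ↑ʳ j) ≈ 0#)
    × (∀ (i : Fin s) (j : Fin t) → congr T A (s ↑ʳ j) (i ↑ˡ t) ≈ - congr T A (i ↑ˡ t) (s ↑ʳ j))

  UpperBlocks : ∀ s t → (Mat (s +ℕ t) (s +ℕ t) → Set (c ⊔ ℓ)) → Mat (s +ℕ t) (s +ℕ t) → Mat s t → Set (c ⊔ ℓ)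
  UpperBlocks s t 𝒜 T B = Σ (Mat (s +ℕ t) (s +ℕ t)) λ A →
    𝒜 A × (∀ (i : Fin s) (j : Fin t) → B i j ≈ congr T A (i ↑ˡ t) (s ↑ʳ j))

  IsMaxNullSum : ∀ {s t} → (Mat s t → Set (c ⊔ ℓ)) → ℕ → Set (lsuc (c ⊔ ℓ))
  IsMaxNullSum {s} {t} ℬ M =
    let Null : (Vec s → Set (c ⊔ ℓ)) → (Vec t → Set (c ⊔ ℓ)) → Set (c ⊔ ℓ)
        Null U V = IsSubspaceᵥ U × IsSubspaceᵥ V
                 × (∀ u v B → U u → V v → ℬ B → form u B v ≈ 0#)
    in (Σ (Vec s → Set (c ⊔ ℓ)) λ U → Σ (Vec t → Set (c ⊔ ℓ)) λ V →
          Σ ℕ λ du → Σ ℕ λ dv → Null U V × HasDim U du × HasDim V dv × du +ℕ dv ≡ M)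
     × (∀ U V du dv → Null U V → HasDim U du → HasDim V dv → du +ℕ dv ≤ℕ M)

  IsNcrk : ∀ {s t} → (Mat s t → Set (c ⊔ ℓ)) → ℕ → Set (lsuc (c ⊔ ℓ))
  IsNcrk {s} {t} ℬ r = Σ ℕ λ M → IsMaxNullSum ℬ M × r ≡ (s +ℕ t) ∸ℕ M

-- Conjugation by T identifies the isotropic spaces of 𝒜 with those of T^t𝒜T, whose matrices are
-- [[0, B], [-B^t, 0]] with B ∈ ℬ. If U ≤ F^s and V ≤ F^t are ℬ-orthogonal then U ⊕ V is isotropic,
-- so dim U + dim V ≤ α(𝒜). Conversely, Gaussian elimination on the first s coordinates splits an
-- isotropic space of dimension α(𝒜) into vectors with independent projections to F^s and an
-- independent family inside F^t, whose spans are ℬ-orthogonal. Hence α(𝒜) is the maximum of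
-- dim U + dim V, which is n - ncrk(ℬ) by definition.
module Submission where

open import Defs
open import Level using (Level; _⊔_)
open import Data.Nat as ℕ using (ℕ)
import Data.Nat.Properties as ℕₚ
open import Data.Fin using (Fin; zero; suc; _↑ˡ_; _↑ʳ_; _≟_; splitAt; punchIn)
import Data.Fin.Properties as Fin
open import Data.Product using (Σ; ∃; _×_; _,_; proj₁; proj₂)
open import Data.Sum using (_⊎_; inj₁; inj₂)
open import Data.Vec.Functional using (_∷_; head; tail; take; drop; insertAt; _++_)
import Data.Vec.Functional.Properties as Vector
open import Function using (_∘_)
open import Relation.Nullary using (¬_; yes; no)
open import Relation.Nullary.Negation using (contradiction; negated-stable; ¬¬-map)
open import Relation.Nullary.Decidable using (decidable-stable; ¬¬-excluded-middle)
open import Relation.Binary.PropositionalEquality as ≡ using (_≡_)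
import Algebra.Properties.Semiring.Sum as SemiringSum
import Algebra.Properties.Ring as RingProperties
import Algebra.Properties.CommutativeSemigroup as CommutativeSemigroupProperties
import Relation.Binary.Reasoning.Setoid as SetoidReasoning

private
  _>>=_ : ∀ {a b} {A : Set a} {B : Set b} → ¬ ¬ A → (A → ¬ ¬ B) → ¬ ¬ B
  ¬¬a >>= f = negated-stable (¬¬-map f ¬¬a)

  return : ∀ {a} {A : Set a} → A → ¬ ¬ A
  return a ¬a = ¬a a

¬¬-∀⊎∃¬ : ∀ {p} n (P : Fin n → Set p) → ¬ ¬ ((∀ i → P i) ⊎ ∃ λ i → ¬ P i)
¬¬-∀⊎∃¬ ℕ.zero    P = return (inj₁ λ ())
¬¬-∀⊎∃¬ (ℕ.suc n) P = do
  yes P0 ← ¬¬-excluded-middle {A = P zero}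
    where no ¬P0 → return (inj₂ (zero , ¬P0))
  inj₁ P∘suc ← ¬¬-∀⊎∃¬ n (P ∘ suc)
    where inj₂ (i , ¬Pi) → return (inj₂ (suc i , ¬Pi))
  return (inj₁ λ { zero → P0 ; (suc i) → P∘suc i })

↑ˡ-↑ʳ-elim : ∀ m n {p} (P : Fin (m ℕ.+ n) → Set p) →
             (∀ i → P (i ↑ˡ n)) → (∀ j → P (m ↑ʳ j)) → ∀ k → P k
↑ˡ-↑ʳ-elim m n P left right k with splitAt m k | Fin.join-splitAt m n k
... | inj₁ i | eq = ≡.subst P eq (left i)
... | inj₂ j | eq = ≡.subst P eq (right j)

module _ {c ℓ} (F : Field c ℓ) where
  open Field F hiding (zero)
  open LinAlg F
  private module Sum = SemiringSum semiring
  open RingProperties ring using (-‿distribˡ-*; -1*x≈-x)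
  open CommutativeSemigroupProperties *-commutativeSemigroup
    using (x∙yz≈y∙xz; x∙yz≈yx∙z; xy∙z≈x∙zy; xy∙z≈zy∙x)
  open SetoidReasoning setoid

  ∑≡sum : ∀ {n} (f : Fin n → Carrier) → ∑ f ≡ Sum.sum f
  ∑≡sum {ℕ.zero}  f = ≡.refl
  ∑≡sum {ℕ.suc n} f = ≡.cong (f zero +_) (∑≡sum (f ∘ suc))

  ∑-cong : ∀ {n} {f g : Fin n → Carrier} → (∀ i → f i ≈ g i) → ∑ f ≈ ∑ g
  ∑-cong {ℕ.zero}  f≈g = refl
  ∑-cong {ℕ.suc n} f≈g = +-cong (f≈g zero) (∑-cong (f≈g ∘ suc))

  ∑-zero : ∀ {n} {f : Fin n → Carrier} → (∀ i → f i ≈ 0#) → ∑ f ≈ 0#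
  ∑-zero {ℕ.zero}  f≈0 = refl
  ∑-zero {ℕ.suc n} f≈0 = trans (+-cong (f≈0 zero) (∑-zero (f≈0 ∘ suc))) (+-identityˡ 0#)

  ∑-distrib-+ : ∀ {n} (f g : Fin n → Carrier) → ∑ (λ i → f i + g i) ≈ ∑ f + ∑ g
  ∑-distrib-+ f g = begin
    ∑ (λ i → f i + g i)      ≡⟨ ∑≡sum (λ i → f i + g i) ⟩
    Sum.sum (λ i → f i + g i) ≈⟨ Sum.∑-distrib-+ f g ⟩
    Sum.sum f + Sum.sum g     ≡⟨ ≡.cong₂ _+_ (∑≡sum f) (∑≡sum g) ⟨
    ∑ f + ∑ g                 ∎

  *-distribˡ-∑ : ∀ {n} x (f : Fin n → Carrier) → x * ∑ f ≈ ∑ (λ i → x * f i)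
  *-distribˡ-∑ x f = begin
    x * ∑ f                 ≡⟨ ≡.cong (x *_) (∑≡sum f) ⟩
    x * Sum.sum f           ≈⟨ Sum.*-distribˡ-sum x f ⟩
    Sum.sum (λ i → x * f i) ≡⟨ ∑≡sum (λ i → x * f i) ⟨
    ∑ (λ i → x * f i)       ∎

  *-distribʳ-∑ : ∀ {n} x (f : Fin n → Carrier) → ∑ f * x ≈ ∑ (λ i → f i * x)
  *-distribʳ-∑ x f = begin
    ∑ f * x                 ≡⟨ ≡.cong (_* x) (∑≡sum f) ⟩
    Sum.sum f * x           ≈⟨ Sum.*-distribʳ-sum x f ⟩
    Sum.sum (λ i → f i * x) ≡⟨ ∑≡sum (λ i → f i * x) ⟨
    ∑ (λ i → f i * x)       ∎

  ∑-remove : ∀ {n} (i : Fin (ℕ.suc n)) (f : Fin (ℕ.suc n) → Carrier) → ∑ f ≈ f i + ∑ (f ∘ punchIn i)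
  ∑-remove i f = begin
    ∑ f                           ≡⟨ ∑≡sum f ⟩
    Sum.sum f                     ≈⟨ Sum.sum-remove {i = i} f ⟩
    f i + Sum.sum (f ∘ punchIn i) ≡⟨ ≡.cong (f i +_) (∑≡sum (f ∘ punchIn i)) ⟨
    f i + ∑ (f ∘ punchIn i)       ∎

  ∑-comm : ∀ {m n} (f : Fin m → Fin n → Carrier) → ∑ (λ i → ∑ (f i)) ≈ ∑ (λ j → ∑ (λ i → f i j))
  ∑-comm {ℕ.zero}  {n} f = sym (∑-zero {n} (λ _ → refl))
  ∑-comm {ℕ.suc m} f = trans (+-congˡ (∑-comm (f ∘ suc))) (sym (∑-distrib-+ (f zero) (λ j → ∑ (λ i → f (suc i) j))))

  ∑-split : ∀ m {n} (f : Fin (m ℕ.+ n) → Carrier) → ∑ f ≈ ∑ (take m f) + ∑ (drop m f)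
  ∑-split ℕ.zero    f = sym (+-identityˡ _)
  ∑-split (ℕ.suc m) f = trans (+-congˡ (∑-split m (f ∘ suc))) (sym (+-assoc _ _ _))

  ∑-I* : ∀ {n} (k : Fin n) (f : Fin n → Carrier) → ∑ (λ j → I k j * f j) ≈ f k
  ∑-I* {ℕ.suc n} k f = begin
    ∑ (λ j → I k j * f j)                              ≈⟨ ∑-remove k (λ j → I k j * f j) ⟩
    I k k * f k + ∑ (λ j → I k (punchIn k j) * f (punchIn k j))
      ≈⟨ +-cong (trans (*-congʳ I-diag) (*-identityˡ _)) (∑-zero (λ j → trans (*-congʳ (I-off j)) (zeroˡ _))) ⟩
    f k + 0#                                           ≈⟨ +-identityʳ _ ⟩
    f k                                                ∎
    where
    I-diag : I k k ≈ 1#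
    I-diag with k ≟ k
    ... | yes _  = refl
    ... | no k≢k = contradiction ≡.refl k≢k
    I-off : ∀ j → I k (punchIn k j) ≈ 0#
    I-off j with k ≟ punchIn k j
    ... | yes k≡pk = contradiction (≡.sym k≡pk) (Fin.punchInᵢ≢i k j)
    ... | no _     = refl

  ≈ᵥ-refl : ∀ {n} {v : Vec n} → v ≈ᵥ v
  ≈ᵥ-refl i = refl

  ≈ᵥ-sym : ∀ {n} {u v : Vec n} → u ≈ᵥ v → v ≈ᵥ u
  ≈ᵥ-sym u≈v i = sym (u≈v i)

  ≈ᵥ-trans : ∀ {n} {u v w : Vec n} → u ≈ᵥ v → v ≈ᵥ w → u ≈ᵥ w
  ≈ᵥ-trans u≈v v≈w i = trans (u≈v i) (v≈w i)

  Span : ∀ {n d} → (Fin d → Vec n) → Vec n → Set (c ⊔ ℓ)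
  Span b v = Σ (Fin _ → Carrier) λ co → v ≈ᵥ lincomb co b

  Independent : ∀ {n d} → (Fin d → Vec n) → Set (c ⊔ ℓ)
  Independent b = ∀ co → lincomb co b ≈ᵥ 0ᵥ → ∀ k → co k ≈ 0#

  lincomb-cong : ∀ {n d} (co : Fin d → Carrier) {b b′ : Fin d → Vec n} →
                 (∀ k → b k ≈ᵥ b′ k) → lincomb co b ≈ᵥ lincomb co b′
  lincomb-cong co b≈b′ i = ∑-cong (λ k → *-congˡ (b≈b′ k i))

  lincomb-zeroˡ : ∀ {n d} (b : Fin d → Vec n) → lincomb (λ _ → 0#) b ≈ᵥ 0ᵥ
  lincomb-zeroˡ b i = ∑-zero (λ k → zeroˡ (b k i))

  lincomb-zeroʳ : ∀ {n d} (co : Fin d → Carrier) {b : Fin d → Vec n} → (∀ k → b k ≈ᵥ 0ᵥ) → lincomb co b ≈ᵥ 0ᵥ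
  lincomb-zeroʳ co b≈0 i = ∑-zero (λ k → trans (*-congˡ (b≈0 k i)) (zeroʳ (co k)))

  lincomb-+ : ∀ {n d} (co co′ : Fin d → Carrier) (b : Fin d → Vec n) →
              lincomb (λ k → co k + co′ k) b ≈ᵥ lincomb co b +ᵥ lincomb co′ b
  lincomb-+ co co′ b i =
    trans (∑-cong (λ k → distribʳ (b k i) (co k) (co′ k))) (∑-distrib-+ (λ k → co k * b k i) (λ k → co′ k * b k i))

  lincomb-* : ∀ {n d} x (co : Fin d → Carrier) (b : Fin d → Vec n) →
              lincomb (λ k → x * co k) b ≈ᵥ x ·ᵥ lincomb co b
  lincomb-* x co b i = trans (∑-cong (λ k → *-assoc x (co k) (b k i))) (sym (*-distribˡ-∑ x (λ k → co k * b k i)))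

  ∈-Span : ∀ {n d} (b : Fin d → Vec n) k → Span b (b k)
  ∈-Span b k = I k , λ i → sym (∑-I* k (λ j → b j i))

  Span-isSubspace : ∀ {n d} (b : Fin d → Vec n) → IsSubspaceᵥ (Span b)
  Span-isSubspace b = record
    { resp  = λ { u≈v (co , u≈) → co , ≈ᵥ-trans (≈ᵥ-sym u≈v) u≈ }
    ; zero∈ = (λ _ → 0#) , ≈ᵥ-sym (lincomb-zeroˡ b)
    ; +∈    = λ { (co , u≈) (co′ , v≈) →
                (λ k → co k + co′ k) , ≈ᵥ-trans (λ i → +-cong (u≈ i) (v≈ i)) (≈ᵥ-sym (lincomb-+ co co′ b)) }
    ; ·∈    = λ { x (co , u≈) → (λ k → x * co k) , ≈ᵥ-trans (λ i → *-congˡ (u≈ i)) (≈ᵥ-sym (lincomb-* x co b)) }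
    }

  lincomb∈ : ∀ {n d} {U : Vec n → Set (c ⊔ ℓ)} → IsSubspaceᵥ U →
             (b : Fin d → Vec n) → (∀ k → U (b k)) → ∀ co → U (lincomb co b)
  lincomb∈ {d = ℕ.zero}  U-sub b b∈U co = IsSubspaceᵥ.zero∈ U-sub
  lincomb∈ {d = ℕ.suc d} U-sub b b∈U co =
    IsSubspaceᵥ.+∈ U-sub (IsSubspaceᵥ.·∈ U-sub (co zero) (b∈U zero)) (lincomb∈ U-sub (b ∘ suc) (b∈U ∘ suc) (co ∘ suc))

  Span⊆ : ∀ {n d} {U : Vec n → Set (c ⊔ ℓ)} → IsSubspaceᵥ U →
          (b : Fin d → Vec n) → (∀ k → U (b k)) → ∀ {v} → Span b v → U v
  Span⊆ U-sub b b∈U (co , v≈) = IsSubspaceᵥ.resp U-sub (≈ᵥ-sym v≈) (lincomb∈ U-sub b b∈U co)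

  Independent⇒HasDim : ∀ {n d} (b : Fin d → Vec n) → Independent b → HasDim (Span b) d
  Independent⇒HasDim b b-ind = b , ∈-Span b , b-ind , λ v v∈ → v∈

  infixr 7 _⊗ᵥ_
  _⊗ᵥ_ : ∀ {m n} → Mat m n → Vec n → Vec m
  (M ⊗ᵥ v) i = ∑ λ j → M i j * v j

  ⟨_,_⟩ : ∀ {n} → Vec n → Vec n → Carrier
  ⟨ u , v ⟩ = ∑ λ i → u i * v i

  ⊗ᵥ-congʳ : ∀ {m n} (M : Mat m n) {v v′ : Vec n} → v ≈ᵥ v′ → M ⊗ᵥ v ≈ᵥ M ⊗ᵥ v′
  ⊗ᵥ-congʳ M v≈v′ i = ∑-cong (λ j → *-congˡ (v≈v′ j))

  ⊗ᵥ-congˡ : ∀ {m n} {M M′ : Mat m n} (v : Vec n) → M ≈ₘ M′ → M ⊗ᵥ v ≈ᵥ M′ ⊗ᵥ v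
  ⊗ᵥ-congˡ v M≈M′ i = ∑-cong (λ j → *-congʳ (M≈M′ i j))

  ⊗ᵥ-zeroʳ : ∀ {m n} (M : Mat m n) → M ⊗ᵥ 0ᵥ ≈ᵥ 0ᵥ
  ⊗ᵥ-zeroʳ M i = ∑-zero (λ j → zeroʳ (M i j))

  ⊗ᵥ-lincomb : ∀ {m n d} (M : Mat m n) (co : Fin d → Carrier) (b : Fin d → Vec n) →
               M ⊗ᵥ lincomb co b ≈ᵥ lincomb co (λ k → M ⊗ᵥ b k)
  ⊗ᵥ-lincomb M co b i = begin
    ∑ (λ j → M i j * ∑ (λ k → co k * b k j))   ≈⟨ ∑-cong (λ j → *-distribˡ-∑ (M i j) (λ k → co k * b k j)) ⟩
    ∑ (λ j → ∑ (λ k → M i j * (co k * b k j))) ≈⟨ ∑-comm (λ j k → M i j * (co k * b k j)) ⟩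
    ∑ (λ k → ∑ (λ j → M i j * (co k * b k j))) ≈⟨ ∑-cong (λ k → ∑-cong (λ j → x∙yz≈y∙xz (M i j) (co k) (b k j))) ⟩
    ∑ (λ k → ∑ (λ j → co k * (M i j * b k j))) ≈⟨ ∑-cong (λ k → *-distribˡ-∑ (co k) (λ j → M i j * b k j)) ⟨
    ∑ (λ k → co k * ∑ (λ j → M i j * b k j))   ∎

  ⊗-⊗ᵥ : ∀ {m k n} (M : Mat m k) (Q : Mat k n) (v : Vec n) → (M ⊗ Q) ⊗ᵥ v ≈ᵥ M ⊗ᵥ (Q ⊗ᵥ v)
  ⊗-⊗ᵥ M Q v i = begin
    ∑ (λ j → ∑ (λ l → M i l * Q l j) * v j)   ≈⟨ ∑-cong (λ j → *-distribʳ-∑ (v j) (λ l → M i l * Q l j)) ⟩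
    ∑ (λ j → ∑ (λ l → (M i l * Q l j) * v j)) ≈⟨ ∑-comm (λ j l → (M i l * Q l j) * v j) ⟩
    ∑ (λ l → ∑ (λ j → (M i l * Q l j) * v j)) ≈⟨ ∑-cong (λ l → ∑-cong (λ j → *-assoc (M i l) (Q l j) (v j))) ⟩
    ∑ (λ l → ∑ (λ j → M i l * (Q l j * v j))) ≈⟨ ∑-cong (λ l → *-distribˡ-∑ (M i l) (λ j → Q l j * v j)) ⟨
    ∑ (λ l → M i l * ∑ (λ j → Q l j * v j))   ∎

  ⊗ᵥ-cancelˡ : ∀ {n} {T T′ : Mat n n} → (T′ ⊗ T) ≈ₘ I → ∀ v → T′ ⊗ᵥ T ⊗ᵥ v ≈ᵥ v
  ⊗ᵥ-cancelˡ {T = T} {T′} T′T≈I v =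
    ≈ᵥ-trans (≈ᵥ-sym (⊗-⊗ᵥ T′ T v)) (≈ᵥ-trans (⊗ᵥ-congˡ v T′T≈I) (λ i → ∑-I* i v))

  ⊗ᵥ-independent : ∀ {n d} {T T′ : Mat n n} → (T′ ⊗ T) ≈ₘ I →
                   {b : Fin d → Vec n} → Independent b → Independent (λ k → T ⊗ᵥ b k)
  ⊗ᵥ-independent {T = T} {T′} T′T≈I {b} b-ind co Tb≈0 = b-ind co λ i → begin
    lincomb co b i                           ≈⟨ lincomb-cong co (λ k → ≈ᵥ-sym (⊗ᵥ-cancelˡ T′T≈I (b k))) i ⟩
    lincomb co (λ k → T′ ⊗ᵥ T ⊗ᵥ b k) i      ≈⟨ ⊗ᵥ-lincomb T′ co (λ k → T ⊗ᵥ b k) i ⟨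
    (T′ ⊗ᵥ lincomb co (λ k → T ⊗ᵥ b k)) i    ≈⟨ ⊗ᵥ-congʳ T′ Tb≈0 i ⟩
    (T′ ⊗ᵥ 0ᵥ) i                             ≈⟨ ⊗ᵥ-zeroʳ T′ i ⟩
    0#                                       ∎

  ⊗ᵥ-Span : ∀ {m n d} (M : Mat m n) {b : Fin d → Vec n} {v} → Span b v → Span (λ k → M ⊗ᵥ b k) (M ⊗ᵥ v)
  ⊗ᵥ-Span M {b} (co , v≈) = co , ≈ᵥ-trans (⊗ᵥ-congʳ M v≈) (⊗ᵥ-lincomb M co b)

  form-cong : ∀ {m n} {u u′ : Vec m} {A A′ : Mat m n} {v v′ : Vec n} →
              u ≈ᵥ u′ → A ≈ₘ A′ → v ≈ᵥ v′ → form u A v ≈ form u′ A′ v′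
  form-cong u≈ A≈ v≈ = ∑-cong (λ i → ∑-cong (λ j → *-cong (*-cong (u≈ i) (A≈ i j)) (v≈ j)))

  form≈⟨,⊗ᵥ⟩ : ∀ {m n} (u : Vec m) (A : Mat m n) (v : Vec n) → form u A v ≈ ⟨ u , A ⊗ᵥ v ⟩
  form≈⟨,⊗ᵥ⟩ u A v = ∑-cong (λ i →
    trans (∑-cong (λ j → *-assoc (u i) (A i j) (v j))) (sym (*-distribˡ-∑ (u i) (λ j → A i j * v j))))

  form-ᵀ : ∀ {m n} (u : Vec m) (A : Mat m n) (v : Vec n) → form u A v ≈ form v (A ᵀ) u
  form-ᵀ u A v = trans (∑-comm (λ i j → (u i * A i j) * v j))
                       (∑-cong (λ j → ∑-cong (λ i → xy∙z≈zy∙x (u i) (A i j) (v j))))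

  ⟨,ᵀ⊗ᵥ⟩ : ∀ {n} (T : Mat n n) (u v : Vec n) → ⟨ u , T ᵀ ⊗ᵥ v ⟩ ≈ ⟨ T ⊗ᵥ u , v ⟩
  ⟨,ᵀ⊗ᵥ⟩ T u v = begin
    ∑ (λ i → u i * ∑ (λ j → T j i * v j))   ≈⟨ ∑-cong (λ i → *-distribˡ-∑ (u i) (λ j → T j i * v j)) ⟩
    ∑ (λ i → ∑ (λ j → u i * (T j i * v j))) ≈⟨ ∑-comm (λ i j → u i * (T j i * v j)) ⟩
    ∑ (λ j → ∑ (λ i → u i * (T j i * v j))) ≈⟨ ∑-cong (λ j → ∑-cong (λ i → x∙yz≈yx∙z (u i) (T j i) (v j))) ⟩
    ∑ (λ j → ∑ (λ i → (T j i * u i) * v j)) ≈⟨ ∑-cong (λ j → *-distribʳ-∑ (v j) (λ i → T j i * u i)) ⟨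
    ∑ (λ j → ∑ (λ i → T j i * u i) * v j)   ∎

  form-congr : ∀ {n} (T A : Mat n n) (x y : Vec n) → form x (congr T A) y ≈ form (T ⊗ᵥ x) A (T ⊗ᵥ y)
  form-congr T A x y = begin
    form x (((T ᵀ) ⊗ A) ⊗ T) y             ≈⟨ form≈⟨,⊗ᵥ⟩ x _ y ⟩
    ⟨ x , (((T ᵀ) ⊗ A) ⊗ T) ⊗ᵥ y ⟩         ≈⟨ ∑-cong (λ i → *-congˡ (⊗-⊗ᵥ ((T ᵀ) ⊗ A) T y i)) ⟩
    ⟨ x , ((T ᵀ) ⊗ A) ⊗ᵥ T ⊗ᵥ y ⟩          ≈⟨ ∑-cong (λ i → *-congˡ (⊗-⊗ᵥ (T ᵀ) A (T ⊗ᵥ y) i)) ⟩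
    ⟨ x , T ᵀ ⊗ᵥ A ⊗ᵥ T ⊗ᵥ y ⟩           ≈⟨ ⟨,ᵀ⊗ᵥ⟩ T x (A ⊗ᵥ T ⊗ᵥ y) ⟩
    ⟨ T ⊗ᵥ x , A ⊗ᵥ T ⊗ᵥ y ⟩             ≈⟨ form≈⟨,⊗ᵥ⟩ (T ⊗ᵥ x) A (T ⊗ᵥ y) ⟨
    form (T ⊗ᵥ x) A (T ⊗ᵥ y)             ∎

  form-lincombʳ : ∀ {m n d} (u : Vec m) (A : Mat m n) (co : Fin d → Carrier) (b : Fin d → Vec n) →
                  form u A (lincomb co b) ≈ ∑ (λ k → co k * form u A (b k))
  form-lincombʳ u A co b = begin
    form u A (lincomb co b)                       ≈⟨ form≈⟨,⊗ᵥ⟩ u A (lincomb co b) ⟩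
    ∑ (λ i → u i * (A ⊗ᵥ lincomb co b) i)         ≈⟨ ∑-cong (λ i → *-congˡ (⊗ᵥ-lincomb A co b i)) ⟩
    ∑ (λ i → u i * ∑ (λ k → co k * Ab k i))       ≈⟨ ∑-cong (λ i → *-distribˡ-∑ (u i) (λ k → co k * Ab k i)) ⟩
    ∑ (λ i → ∑ (λ k → u i * (co k * Ab k i)))     ≈⟨ ∑-comm (λ i k → u i * (co k * Ab k i)) ⟩
    ∑ (λ k → ∑ (λ i → u i * (co k * Ab k i)))     ≈⟨ ∑-cong (λ k → ∑-cong (λ i → x∙yz≈y∙xz (u i) (co k) (Ab k i))) ⟩
    ∑ (λ k → ∑ (λ i → co k * (u i * Ab k i)))     ≈⟨ ∑-cong (λ k → *-distribˡ-∑ (co k) (λ i → u i * Ab k i)) ⟨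
    ∑ (λ k → co k * ⟨ u , Ab k ⟩)                 ≈⟨ ∑-cong (λ k → *-congˡ (form≈⟨,⊗ᵥ⟩ u A (b k))) ⟨
    ∑ (λ k → co k * form u A (b k))               ∎
    where
    Ab : Fin _ → Vec _
    Ab k = A ⊗ᵥ b k

  form-Spanʳ : ∀ {m n d} {x : Vec m} {A : Mat m n} {b : Fin d → Vec n} →
               (∀ k → form x A (b k) ≈ 0#) → ∀ {y} → Span b y → form x A y ≈ 0#
  form-Spanʳ {x = x} {A} {b} x⊥b {y} (co , y≈) = begin
    form x A y                       ≈⟨ form-cong {u = x} {A = A} ≈ᵥ-refl (λ _ _ → refl) y≈ ⟩
    form x A (lincomb co b)          ≈⟨ form-lincombʳ x A co b ⟩
    ∑ (λ k → co k * form x A (b k))  ≈⟨ ∑-zero (λ k → trans (*-congˡ (x⊥b k)) (zeroʳ (co k))) ⟩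
    0#                               ∎

  form-Span : ∀ {m n d e} {b : Fin d → Vec m} {A : Mat m n} {b′ : Fin e → Vec n} →
              (∀ k l → form (b k) A (b′ l) ≈ 0#) → ∀ {x y} → Span b x → Span b′ y → form x A y ≈ 0#
  form-Span {b = b} {A} b⊥b′ {x} {y} x∈ y∈ = trans (form-ᵀ x A y) (form-Spanʳ {x = y} {A = A ᵀ} y⊥b x∈)
    where
    y⊥b : ∀ k → form y (A ᵀ) (b k) ≈ 0#
    y⊥b k = trans (sym (form-ᵀ (b k) A y)) (form-Spanʳ {x = b k} {A = A} (b⊥b′ k) y∈)

  form-zeroʳ : ∀ {m n} (u : Vec m) (A : Mat m n) {v : Vec n} → v ≈ᵥ 0ᵥ → form u A v ≈ 0#
  form-zeroʳ {m} {n} u A v≈0 = ∑-zero {m} (λ i → ∑-zero {n} (λ j → trans (*-congˡ (v≈0 j)) (zeroʳ _)))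

  form-zeroᴬ : ∀ {m n} (u : Vec m) {A : Mat m n} (v : Vec n) → A ≈ₘ 0ₘ → form u A v ≈ 0#
  form-zeroᴬ {m} {n} u v A≈0 = ∑-zero {m} (λ i → ∑-zero {n} (λ j →
    trans (*-congʳ (trans (*-congˡ (A≈0 i j)) (zeroʳ (u i)))) (zeroˡ (v j))))

  form-·ₘ : ∀ {m n} x (u : Vec m) (A : Mat m n) (v : Vec n) → form u (x ·ₘ A) v ≈ x * form u A v
  form-·ₘ x u A v = begin
    ∑ (λ i → ∑ (λ j → (u i * (x * A i j)) * v j))   ≈⟨ ∑-cong (λ i → ∑-cong (λ j → pull-x (u i) (A i j) (v j))) ⟩
    ∑ (λ i → ∑ (λ j → x * ((u i * A i j) * v j)))   ≈⟨ ∑-cong (λ i → *-distribˡ-∑ x (λ j → (u i * A i j) * v j)) ⟨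
    ∑ (λ i → x * ∑ (λ j → (u i * A i j) * v j))     ≈⟨ *-distribˡ-∑ x (λ i → ∑ (λ j → (u i * A i j) * v j)) ⟨
    x * form u A v                                  ∎
    where
    pull-x : ∀ y a z → (y * (x * a)) * z ≈ x * ((y * a) * z)
    pull-x y a z = trans (*-congʳ (x∙yz≈y∙xz y x a)) (*-assoc x (y * a) z)

  take-++ : ∀ {m n} (u : Vec m) (v : Vec n) → take m (u ++ v) ≈ᵥ u
  take-++ u v i = reflexive (Vector.lookup-++ˡ u v i)

  drop-++ : ∀ {m n} (u : Vec m) (v : Vec n) → drop m (u ++ v) ≈ᵥ v
  drop-++ u v i = reflexive (Vector.lookup-++ʳ u v i)

  module Blocks (s t : ℕ) where
    topLeft : Mat (s ℕ.+ t) (s ℕ.+ t) → Mat s s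
    topLeft M i j = M (i ↑ˡ t) (j ↑ˡ t)

    topRight : Mat (s ℕ.+ t) (s ℕ.+ t) → Mat s t
    topRight M i j = M (i ↑ˡ t) (s ↑ʳ j)

    bottomLeft : Mat (s ℕ.+ t) (s ℕ.+ t) → Mat t s
    bottomLeft M i j = M (s ↑ʳ i) (j ↑ˡ t)

    bottomRight : Mat (s ℕ.+ t) (s ℕ.+ t) → Mat t t
    bottomRight M i j = M (s ↑ʳ i) (s ↑ʳ j)

    SkewOffDiagonal : Mat (s ℕ.+ t) (s ℕ.+ t) → Set ℓ
    SkewOffDiagonal M = topLeft M ≈ₘ 0ₘ × bottomRight M ≈ₘ 0ₘ × (∀ i j → bottomLeft M j i ≈ - topRight M i j)

    form-blocks : ∀ x M y → form x M y ≈
      (form (take s x) (topLeft M) (take s y) + form (take s x) (topRight M) (drop s y)) +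
      (form (drop s x) (bottomLeft M) (take s y) + form (drop s x) (bottomRight M) (drop s y))
    form-blocks x M y =
      trans (∑-split s row) (+-cong (split-columns (take s x) (_↑ˡ t)) (split-columns (drop s x) (s ↑ʳ_)))
      where
      row : Fin (s ℕ.+ t) → Carrier
      row i = ∑ (λ j → (x i * M i j) * y j)
      split-columns : ∀ {r} (x′ : Vec r) (ι : Fin r → Fin (s ℕ.+ t)) →
        ∑ (λ i → ∑ (λ j → (x′ i * M (ι i) j) * y j)) ≈
        form x′ (λ i j → M (ι i) (j ↑ˡ t)) (take s y) + form x′ (λ i j → M (ι i) (s ↑ʳ j)) (drop s y)
      split-columns x′ ι = trans (∑-cong (λ i → ∑-split s (λ j → (x′ i * M (ι i) j) * y j)))
                                   (∑-distrib-+ (λ i → ∑ (λ j → (x′ i * M (ι i) (j ↑ˡ t)) * y (j ↑ˡ t)))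
                                                (λ i → ∑ (λ j → (x′ i * M (ι i) (s ↑ʳ j)) * y (s ↑ʳ j))))

    form-topRight : ∀ x M {y} → take s y ≈ᵥ 0ᵥ → bottomRight M ≈ₘ 0ₘ →
                    form x M y ≈ form (take s x) (topRight M) (drop s y)
    form-topRight x M {y} y↑≈0 M↘≈0 = begin
      form x M y
        ≈⟨ form-blocks x M y ⟩
      (form (take s x) (topLeft M) (take s y) + B) + (form (drop s x) (bottomLeft M) (take s y) + form (drop s x) (bottomRight M) (drop s y))
        ≈⟨ +-cong (+-congʳ (form-zeroʳ (take s x) (topLeft M) y↑≈0))
                  (+-cong (form-zeroʳ (drop s x) (bottomLeft M) y↑≈0) (form-zeroᴬ (drop s x) (drop s y) M↘≈0)) ⟩
      (0# + B) + (0# + 0#)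
        ≈⟨ trans (+-cong (+-identityˡ B) (+-identityˡ 0#)) (+-identityʳ B) ⟩
      B ∎
      where B = form (take s x) (topRight M) (drop s y)

    form-++≈0 : ∀ {M} → SkewOffDiagonal M → ∀ {u v u′ v′} →
                form u (topRight M) v′ ≈ 0# → form u′ (topRight M) v ≈ 0# → form (u ++ v) M (u′ ++ v′) ≈ 0#
    form-++≈0 {M} (M↖≈0 , M↘≈0 , M↙≈-M↗ᵀ) {u} {v} {u′} {v′} u⊥v′ u′⊥v = begin
      form (u ++ v) M (u′ ++ v′)
        ≈⟨ form-blocks (u ++ v) M (u′ ++ v′) ⟩
      (form _ (topLeft M) _ + form _ (topRight M) _) + (form _ (bottomLeft M) _ + form _ (bottomRight M) _)
        ≈⟨ +-cong (+-cong (form-zeroᴬ _ _ M↖≈0) (trans (form-cong (take-++ u v) (λ _ _ → refl) (drop-++ u′ v′)) u⊥v′))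
                  (+-cong (trans (form-cong (drop-++ u v) (λ _ _ → refl) (take-++ u′ v′)) v⊥u′) (form-zeroᴬ _ _ M↘≈0)) ⟩
      (0# + 0#) + (0# + 0#)
        ≈⟨ trans (+-cong (+-identityˡ 0#) (+-identityˡ 0#)) (+-identityˡ 0#) ⟩
      0# ∎
      where
      v⊥u′ : form v (bottomLeft M) u′ ≈ 0#
      v⊥u′ = begin
        form v (bottomLeft M) u′              ≈⟨ form-cong ≈ᵥ-refl M↙≈-1·M↗ᵀ ≈ᵥ-refl ⟩
        form v ((- 1#) ·ₘ (topRight M ᵀ)) u′  ≈⟨ form-·ₘ (- 1#) v (topRight M ᵀ) u′ ⟩
        - 1# * form v (topRight M ᵀ) u′       ≈⟨ *-congˡ (form-ᵀ u′ (topRight M) v) ⟨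
        - 1# * form u′ (topRight M) v         ≈⟨ *-congˡ u′⊥v ⟩
        - 1# * 0#                             ≈⟨ zeroʳ (- 1#) ⟩
        0#                                    ∎
        where
        M↙≈-1·M↗ᵀ : bottomLeft M ≈ₘ (- 1#) ·ₘ (topRight M ᵀ)
        M↙≈-1·M↗ᵀ j i = trans (M↙≈-M↗ᵀ i j) (sym (-1*x≈-x _))

  x*y≈0⇒x≈0 : ∀ {x y} → ¬ y ≈ 0# → x * y ≈ 0# → x ≈ 0#
  x*y≈0⇒x≈0 {x} {y} y≉0 xy≈0 = begin
    x             ≈⟨ *-identityʳ x ⟨
    x * 1#        ≈⟨ *-congˡ (proj₂ (inverse y y≉0)) ⟨
    x * (y * y⁻¹) ≈⟨ *-assoc x y y⁻¹ ⟨
    (x * y) * y⁻¹ ≈⟨ *-congʳ xy≈0 ⟩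
    0# * y⁻¹      ≈⟨ zeroˡ y⁻¹ ⟩
    0#            ∎
    where y⁻¹ = proj₁ (inverse y y≉0)

  tail-preserves-independent : ∀ {N d} {w : Fin d → Vec (ℕ.suc N)} →
                               (∀ i → head (w i) ≈ 0#) → Independent w → Independent (tail ∘ w)
  tail-preserves-independent {d = d} w₀≈0 w-ind co eq = w-ind co λ where
    zero    → ∑-zero {d} (λ i → trans (*-congˡ (w₀≈0 i)) (zeroʳ (co i)))
    (suc x) → eq x

  tail-reflects-independent : ∀ {N d} {w : Fin d → Vec (ℕ.suc N)} → Independent (tail ∘ w) → Independent w
  tail-reflects-independent tail-ind co eq = tail-ind co (eq ∘ suc)

  ∷-Span : ∀ {N d} {w : Fin d → Vec (ℕ.suc N)} → (∀ i → head (w i) ≈ 0#) → ∀ {v} → Span (tail ∘ w) v → Span w (0# ∷ v)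
  ∷-Span {d = d} w₀≈0 (co , v≈) = co , λ where
    zero    → sym (∑-zero {d} (λ i → trans (*-congˡ (w₀≈0 i)) (zeroʳ (co i))))
    (suc x) → v≈ x

  independent-∷ : ∀ {N k} (f : Fin (ℕ.suc k) → Vec (ℕ.suc N)) → ¬ head (f zero) ≈ 0# →
                  (∀ i → head (f (suc i)) ≈ 0#) → Independent (tail ∘ f ∘ suc) → Independent f
  independent-∷ {k = k} f f₀₀≉0 f₀≈0 tail-ind co eq = λ where
      zero    → co₀≈0
      (suc i) → tail-ind (co ∘ suc) rest≈0 i
    where
    rest₀≈0 : ∑ (λ i → co (suc i) * head (f (suc i))) ≈ 0#
    rest₀≈0 = ∑-zero {k} (λ i → trans (*-congˡ (f₀≈0 i)) (zeroʳ (co (suc i))))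

    co₀≈0 : co zero ≈ 0#
    co₀≈0 = x*y≈0⇒x≈0 f₀₀≉0 (begin
      co zero * head (f zero)                                        ≈⟨ +-identityʳ _ ⟨
      co zero * head (f zero) + 0#                                   ≈⟨ +-congˡ rest₀≈0 ⟨
      co zero * head (f zero) + ∑ (λ i → co (suc i) * head (f (suc i))) ≈⟨ eq zero ⟩
      0#                                                             ∎)

    rest≈0 : lincomb (co ∘ suc) (tail ∘ f ∘ suc) ≈ᵥ 0ᵥ
    rest≈0 x = begin
      lincomb (co ∘ suc) (tail ∘ f ∘ suc) x                        ≈⟨ +-identityˡ _ ⟨
      0# + lincomb (co ∘ suc) (tail ∘ f ∘ suc) x                   ≈⟨ +-congʳ (trans (*-congʳ co₀≈0) (zeroˡ _)) ⟨
      co zero * f zero (suc x) + lincomb (co ∘ suc) (tail ∘ f ∘ suc) x ≈⟨ eq (suc x) ⟩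
      0#                                                           ∎

  independent-shear : ∀ {n a} {w : Fin (ℕ.suc a) → Vec n} (p : Fin (ℕ.suc a)) (κ : Fin a → Carrier) →
                      Independent w → Independent (λ j → w (punchIn p j) +ᵥ (κ j ·ᵥ w p))
  independent-shear {a = a} {w} p κ w-ind co eq j = begin
    co j                          ≡⟨ Vector.insertAt-punchIn co p e j ⟨
    insertAt co p e (punchIn p j) ≈⟨ w-ind (insertAt co p e) (≈ᵥ-trans (≈ᵥ-sym sheared≈) eq) (punchIn p j) ⟩
    0#                            ∎
    where
    e : Carrier
    e = ∑ λ j → co j * κ j
    sheared≈ : lincomb co (λ j → w (punchIn p j) +ᵥ (κ j ·ᵥ w p)) ≈ᵥ lincomb (insertAt co p e) w
    sheared≈ x = begin
      ∑ (λ j → co j * (w (punchIn p j) x + κ j * w p x))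
        ≈⟨ ∑-cong (λ j → distribˡ (co j) (w (punchIn p j) x) (κ j * w p x)) ⟩
      ∑ (λ j → co j * w (punchIn p j) x + co j * (κ j * w p x))
        ≈⟨ ∑-distrib-+ (λ j → co j * w (punchIn p j) x) (λ j → co j * (κ j * w p x)) ⟩
      ∑ (λ j → co j * w (punchIn p j) x) + ∑ (λ j → co j * (κ j * w p x))
        ≈⟨ +-congˡ (trans (∑-cong (λ j → sym (*-assoc (co j) (κ j) (w p x)))) (sym (*-distribʳ-∑ (w p x) (λ j → co j * κ j)))) ⟩
      ∑ (λ j → co j * w (punchIn p j) x) + e * w p x
        ≈⟨ +-comm _ _ ⟩
      e * w p x + ∑ (λ j → co j * w (punchIn p j) x)
        ≈⟨ +-cong (*-congʳ (reflexive (Vector.insertAt-lookup co p e)))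
                  (∑-cong (λ j → *-congʳ (reflexive (Vector.insertAt-punchIn co p e j)))) ⟨
      insertAt co p e p * w p x + ∑ (λ j → insertAt co p e (punchIn p j) * w (punchIn p j) x)
        ≈⟨ ∑-remove p (λ k → insertAt co p e k * w k x) ⟨
      lincomb (insertAt co p e) w x
        ∎

  module Pivot {N a} (w : Fin (ℕ.suc a) → Vec (ℕ.suc N)) (p : Fin (ℕ.suc a)) (w[p]₀≉0 : ¬ head (w p) ≈ 0#) where
    private
      h h⁻¹ : Carrier
      h = head (w p)
      h⁻¹ = proj₁ (inverse h w[p]₀≉0)

      hh⁻¹≈1 : h * h⁻¹ ≈ 1#
      hh⁻¹≈1 = proj₂ (inverse h w[p]₀≉0)

    κ : Fin a → Carrier
    κ j = - (head (w (punchIn p j)) * h⁻¹)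

    cleared : Fin a → Vec (ℕ.suc N)
    cleared j = w (punchIn p j) +ᵥ (κ j ·ᵥ w p)

    cleared-head : ∀ j → head (cleared j) ≈ 0#
    cleared-head j = begin
      x + - (x * h⁻¹) * h   ≈⟨ +-congˡ (-‿distribˡ-* (x * h⁻¹) h) ⟨
      x + - (x * h⁻¹ * h)   ≈⟨ +-congˡ (-‿cong (trans (xy∙z≈x∙zy x h⁻¹ h) (trans (*-congˡ hh⁻¹≈1) (*-identityʳ x)))) ⟩
      x + - x               ≈⟨ -‿inverseʳ x ⟩
      0#                    ∎
      where x = head (w (punchIn p j))

    cleared∈Span : ∀ j → Span w (cleared j)
    cleared∈Span j = IsSubspaceᵥ.+∈ (Span-isSubspace w) (∈-Span w (punchIn p j))
                                    (IsSubspaceᵥ.·∈ (Span-isSubspace w) (κ j) (∈-Span w p))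

    tail-cleared-independent : Independent w → Independent (tail ∘ cleared)
    tail-cleared-independent w-ind = tail-preserves-independent cleared-head (independent-shear {w = w} p κ w-ind)

  -- Rank–nullity for the projection take s on span w; spanning is not recorded, the count
  -- rank + nullity ≡ a stands in for it.
  record KernelAdapted (s : ℕ) {t a} (w : Fin a → Vec (s ℕ.+ t)) : Set (c ⊔ ℓ) where
    field
      rank nullity       : ℕ
      rank+nullity       : rank ℕ.+ nullity ≡ a
      rank≤s             : rank ℕ.≤ s
      lifts              : Fin rank → Vec (s ℕ.+ t)
      kernel             : Fin nullity → Vec (s ℕ.+ t)
      lifts⊆             : ∀ i → Span w (lifts i)
      kernel⊆            : ∀ j → Span w (kernel j)
      lifts-independent  : Independent (take s ∘ lifts)
      kernel-top         : ∀ j → take s (kernel j) ≈ᵥ 0ᵥ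
      kernel-independent : Independent kernel

  KernelAdapted-∷ : ∀ {s t a} {g : Fin a → Vec (ℕ.suc s ℕ.+ t)} →
                    (∀ i → head (g i) ≈ 0#) → KernelAdapted s (tail ∘ g) → KernelAdapted (ℕ.suc s) g
  KernelAdapted-∷ g₀≈0 R = record
    { rank               = rank
    ; nullity            = nullity
    ; rank+nullity       = rank+nullity
    ; rank≤s             = ℕₚ.m≤n⇒m≤1+n rank≤s
    ; lifts              = (0# ∷_) ∘ lifts
    ; kernel             = (0# ∷_) ∘ kernel
    ; lifts⊆             = ∷-Span g₀≈0 ∘ lifts⊆
    ; kernel⊆            = ∷-Span g₀≈0 ∘ kernel⊆
    ; lifts-independent  = tail-reflects-independent lifts-independent
    ; kernel-top         = λ { j zero → refl ; j (suc x) → kernel-top j x }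
    ; kernel-independent = tail-reflects-independent kernel-independent
    }
    where open KernelAdapted R

  KernelAdapted-pivot : ∀ {s t a} (w : Fin (ℕ.suc a) → Vec (ℕ.suc s ℕ.+ t)) p (w[p]₀≉0 : ¬ head (w p) ≈ 0#) →
                        KernelAdapted s (tail ∘ Pivot.cleared w p w[p]₀≉0) → KernelAdapted (ℕ.suc s) w
  KernelAdapted-pivot {s} w p w[p]₀≉0 R = record
    { rank               = ℕ.suc R.rank
    ; nullity            = nullity
    ; rank+nullity       = ≡.cong ℕ.suc rank+nullity
    ; rank≤s             = ℕ.s≤s R.rank≤s
    ; lifts              = w p ∷ lifts
    ; kernel             = kernel
    ; lifts⊆             = λ { zero → ∈-Span w p ; (suc i) → cleared⊆w (lifts⊆ i) }
    ; kernel⊆            = cleared⊆w ∘ kernel⊆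
    ; lifts-independent  = independent-∷ (take (ℕ.suc s) ∘ (w p ∷ lifts)) w[p]₀≉0 (λ _ → refl) R.lifts-independent
    ; kernel-top         = kernel-top
    ; kernel-independent = kernel-independent
    }
    where
    open Pivot w p w[p]₀≉0
    module R = KernelAdapted R
    open KernelAdapted (KernelAdapted-∷ {g = cleared} cleared-head R)
    cleared⊆w : ∀ {v} → Span cleared v → Span w v
    cleared⊆w = Span⊆ (Span-isSubspace w) cleared cleared∈Span

  -- Gaussian elimination on the first s coordinates. Whether a field element is zero is not
  -- decidable, so a pivot can only be found under double negation.
  kernelAdapted : ∀ s {t a} (w : Fin a → Vec (s ℕ.+ t)) → Independent w → ¬ ¬ KernelAdapted s w
  kernelAdapted ℕ.zero {a = a} w w-ind = return record
    { rank               = 0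
    ; nullity            = a
    ; rank+nullity       = ≡.refl
    ; rank≤s             = ℕ.z≤n
    ; lifts              = λ ()
    ; kernel             = w
    ; lifts⊆             = λ ()
    ; kernel⊆            = ∈-Span w
    ; lifts-independent  = λ _ _ ()
    ; kernel-top         = λ _ ()
    ; kernel-independent = w-ind
    }
  kernelAdapted (ℕ.suc s) {t} {a} w w-ind = do
      inj₂ (p , w[p]₀≉0) ← ¬¬-∀⊎∃¬ a (λ i → head (w i) ≈ 0#)
        where inj₁ w₀≈0 → ¬¬-map (KernelAdapted-∷ w₀≈0)
                                  (kernelAdapted s (tail ∘ w) (tail-preserves-independent w₀≈0 w-ind))
      pivot w w-ind p w[p]₀≉0
    where
    pivot : ∀ {a} (w : Fin a → Vec (ℕ.suc s ℕ.+ t)) → Independent w → (p : Fin a) → ¬ head (w p) ≈ 0# →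
            ¬ ¬ KernelAdapted (ℕ.suc s) w
    pivot {ℕ.suc _} w w-ind p w[p]₀≉0 =
      ¬¬-map (KernelAdapted-pivot w p w[p]₀≉0)
             (kernelAdapted s _ (Pivot.tail-cleared-independent w p w[p]₀≉0 w-ind))

  drop-independent : ∀ s {t m} {q : Fin m → Vec (s ℕ.+ t)} →
                     (∀ j → take s (q j) ≈ᵥ 0ᵥ) → Independent q → Independent (drop s ∘ q)
  drop-independent s {t} {q = q} q↑≈0 q-ind co eq =
    q-ind co (↑ˡ-↑ʳ-elim s t (λ k → lincomb co q k ≈ 0#) (lincomb-zeroʳ co q↑≈0) eq)

  independent-zeros⇒empty : ∀ {n m} (q : Fin m → Vec n) → (∀ j → q j ≈ᵥ 0ᵥ) → Independent q → m ≡ 0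
  independent-zeros⇒empty {m = ℕ.zero}  q q≈0 q-ind = ≡.refl
  independent-zeros⇒empty {m = ℕ.suc m} q q≈0 q-ind =
    contradiction (sym (q-ind (λ _ → 1#) (lincomb-zeroʳ (λ _ → 1#) q≈0) zero)) 0≉1

  independent⇒≤ : ∀ {N d} (f : Fin d → Vec N) → Independent f → ¬ ¬ d ℕ.≤ N
  independent⇒≤ {N} {d} f f-ind = ¬¬-map bound (kernelAdapted N f++[] f++[]-independent)
    where
    -- With an empty second block every kernel vector is zero, so the kernel part is empty.
    f++[] : Fin d → Vec (N ℕ.+ 0)
    f++[] i = f i ++ λ ()

    f++[]-independent : Independent f++[]
    f++[]-independent co eq = f-ind co λ x →
      trans (lincomb-cong co (λ k → ≈ᵥ-sym (take-++ (f k) λ ())) x) (eq (x ↑ˡ 0))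

    bound : KernelAdapted N f++[] → d ℕ.≤ N
    bound R = ≡.subst₂ ℕ._≤_ rank+nullity (ℕₚ.+-identityʳ N) (ℕₚ.+-mono-≤ rank≤s (ℕₚ.≤-reflexive nullity≡0))
      where
      open KernelAdapted R
      nullity≡0 : nullity ≡ 0
      nullity≡0 = independent-zeros⇒empty (drop N ∘ kernel) (λ _ ()) (drop-independent N kernel-top kernel-independent)

  Orthogonal : ∀ {s t} → (Mat s t → Set (c ⊔ ℓ)) → (Vec s → Set (c ⊔ ℓ)) → (Vec t → Set (c ⊔ ℓ)) → Set (c ⊔ ℓ)
  Orthogonal ℬ U V = ∀ u v B → U u → V v → ℬ B → form u B v ≈ 0#

  Span-isotropic : ∀ {n d} {𝒜 : Mat n n → Set (c ⊔ ℓ)} (T : Mat n n) (b : Fin d → Vec n) →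
                   (∀ A → 𝒜 A → ∀ k l → form (b k) (congr T A) (b l) ≈ 0#) → Isotropic 𝒜 (Span (λ k → T ⊗ᵥ b k))
  Span-isotropic T b b-iso = Span-isSubspace _ , λ x y A x∈ y∈ A∈ →
    form-Span (λ k l → trans (sym (form-congr T A (b k) (b l))) (b-iso A A∈ k l)) x∈ y∈

  lincomb-++ : ∀ {n d e} (co : Fin (d ℕ.+ e) → Carrier) (f : Fin d → Vec n) (g : Fin e → Vec n) →
               lincomb co (f ++ g) ≈ᵥ lincomb (take d co) f +ᵥ lincomb (drop d co) g
  lincomb-++ {d = d} co f g x = trans (∑-split d (λ k → co k * (f ++ g) k x))
    (+-cong (∑-cong (λ i → *-congˡ (reflexive (≡.cong-app (Vector.lookup-++ˡ f g i) x))))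
            (∑-cong (λ j → *-congˡ (reflexive (≡.cong-app (Vector.lookup-++ʳ f g j) x)))))

  _⊕_ : ∀ {m n du dv} → (Fin du → Vec m) → (Fin dv → Vec n) → Fin (du ℕ.+ dv) → Vec (m ℕ.+ n)
  f ⊕ g = (λ i → f i ++ 0ᵥ) ++ (λ j → 0ᵥ ++ g j)

  ⊕-independent : ∀ {m n du dv} {f : Fin du → Vec m} {g : Fin dv → Vec n} →
                  Independent f → Independent g → Independent (f ⊕ g)
  ⊕-independent {m} {n} {du} {dv} {f} {g} f-ind g-ind co eq =
    ↑ˡ-↑ʳ-elim du dv (λ k → co k ≈ 0#) (f-ind (take du co) top≈0) (g-ind (drop du co) bottom≈0)
    where
    top≈0 : lincomb (take du co) f ≈ᵥ 0ᵥ
    top≈0 x = begin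
      lincomb (take du co) f x
        ≈⟨ +-identityʳ _ ⟨
      lincomb (take du co) f x + 0#
        ≈⟨ +-cong (lincomb-cong (take du co) (λ i → take-++ (f i) 0ᵥ) x)
                  (lincomb-zeroʳ (drop du co) (λ j → take-++ {m} 0ᵥ (g j)) x) ⟨
      lincomb (take du co) (λ i → f i ++ 0ᵥ) (x ↑ˡ n) + lincomb (drop du co) (λ j → 0ᵥ ++ g j) (x ↑ˡ n)
        ≈⟨ lincomb-++ co (λ i → f i ++ 0ᵥ) (λ j → 0ᵥ ++ g j) (x ↑ˡ n) ⟨
      lincomb co (f ⊕ g) (x ↑ˡ n)
        ≈⟨ eq (x ↑ˡ n) ⟩
      0# ∎

    bottom≈0 : lincomb (drop du co) g ≈ᵥ 0ᵥ
    bottom≈0 y = begin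
      lincomb (drop du co) g y
        ≈⟨ +-identityˡ _ ⟨
      0# + lincomb (drop du co) g y
        ≈⟨ +-cong (lincomb-zeroʳ (take du co) (λ i → drop-++ (f i) 0ᵥ) y)
                  (lincomb-cong (drop du co) (λ j → drop-++ {m} 0ᵥ (g j)) y) ⟨
      lincomb (take du co) (λ i → f i ++ 0ᵥ) (m ↑ʳ y) + lincomb (drop du co) (λ j → 0ᵥ ++ g j) (m ↑ʳ y)
        ≈⟨ lincomb-++ co (λ i → f i ++ 0ᵥ) (λ j → 0ᵥ ++ g j) (m ↑ʳ y) ⟨
      lincomb co (f ⊕ g) (m ↑ʳ y)
        ≈⟨ eq (m ↑ʳ y) ⟩
      0# ∎

  ⊕-components : ∀ {m n du dv} {U : Vec m → Set (c ⊔ ℓ)} {V : Vec n → Set (c ⊔ ℓ)} →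
                 IsSubspaceᵥ U → IsSubspaceᵥ V → {f : Fin du → Vec m} {g : Fin dv → Vec n} →
                 (∀ i → U (f i)) → (∀ j → V (g j)) → ∀ k → Σ (Vec m) λ u → Σ (Vec n) λ v → U u × V v × (f ⊕ g) k ≈ᵥ u ++ v
  ⊕-components {du = du} {dv} U-sub V-sub {f} {g} f∈U g∈V = ↑ˡ-↑ʳ-elim du dv _
    (λ i → f i , 0ᵥ , f∈U i , IsSubspaceᵥ.zero∈ V-sub ,
           λ x → reflexive (≡.cong-app (Vector.lookup-++ˡ (λ i → f i ++ 0ᵥ) (λ j → 0ᵥ ++ g j) i) x))
    (λ j → 0ᵥ , g j , IsSubspaceᵥ.zero∈ U-sub , g∈V j ,
           λ x → reflexive (≡.cong-app (Vector.lookup-++ʳ (λ i → f i ++ 0ᵥ) (λ j → 0ᵥ ++ g j) j) x))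

  module _ {s t : ℕ} (𝒜 : Mat (s ℕ.+ t) (s ℕ.+ t) → Set (c ⊔ ℓ)) (T : Mat (s ℕ.+ t) (s ℕ.+ t))
           (blockForm : BlockForm s t 𝒜 T) where
    open Blocks s t

    ⊕-isotropic : ∀ {U V} → IsSubspaceᵥ U → IsSubspaceᵥ V → Orthogonal (UpperBlocks s t 𝒜 T) U V →
                  ∀ {du dv} {f : Fin du → Vec s} {g : Fin dv → Vec t} → (∀ i → U (f i)) → (∀ j → V (g j)) →
                  ∀ A → 𝒜 A → ∀ k l → form ((f ⊕ g) k) (congr T A) ((f ⊕ g) l) ≈ 0#
    ⊕-isotropic U-sub V-sub U⊥V f∈U g∈V A A∈ k l
      with ⊕-components U-sub V-sub f∈U g∈V k | ⊕-components U-sub V-sub f∈U g∈V l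
    ... | u , v , u∈ , v∈ , k≈ | u′ , v′ , u′∈ , v′∈ , l≈ =
      trans (form-cong k≈ (λ _ _ → refl) l≈)
            (form-++≈0 (blockForm A A∈) (U⊥V u v′ _ u∈ v′∈ B∈) (U⊥V u′ v _ u′∈ v∈ B∈))
      where
      B∈ : UpperBlocks s t 𝒜 T (topRight (congr T A))
      B∈ = A , A∈ , λ _ _ → refl

    maxNullSum≤α : Invertible T → ∀ {a M} → IsAlpha 𝒜 a → IsMaxNullSum (UpperBlocks s t 𝒜 T) M → M ℕ.≤ a
    maxNullSum≤α (T′ , _ , T′T≈I) (_ , α-max)
                 ((U , V , du , dv , (U-sub , V-sub , U⊥V) , (f , f∈U , f-ind , _) , (g , g∈V , g-ind , _) , du+dv≡M) , _) =
      ≡.subst (ℕ._≤ _) du+dv≡M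
        (α-max _ (du ℕ.+ dv)
               (Span-isotropic T (f ⊕ g) (⊕-isotropic U-sub V-sub U⊥V f∈U g∈V))
               (Independent⇒HasDim _ (⊗ᵥ-independent T′T≈I (⊕-independent f-ind g-ind))))

    kernelAdapted-orthogonal : ∀ {W a} → Isotropic 𝒜 W → (w : Fin a → Vec (s ℕ.+ t)) →
                               (∀ {v} → Span w v → W (T ⊗ᵥ v)) → (R : KernelAdapted s w) →
                               let open KernelAdapted R in
                               Orthogonal (UpperBlocks s t 𝒜 T) (Span (take s ∘ lifts)) (Span (drop s ∘ kernel))
    kernelAdapted-orthogonal (_ , W-iso) w T[Span-w]⊆W R u v B u∈ v∈ (A , A∈ , B≈) =
      trans (form-cong ≈ᵥ-refl B≈ ≈ᵥ-refl) (form-Span generators⊥ u∈ v∈)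
      where
      open KernelAdapted R
      generators⊥ : ∀ i j → form (take s (lifts i)) (topRight (congr T A)) (drop s (kernel j)) ≈ 0#
      generators⊥ i j = begin
        form (take s (lifts i)) (topRight (congr T A)) (drop s (kernel j))
          ≈⟨ form-topRight (lifts i) (congr T A) (kernel-top j) (proj₁ (proj₂ (blockForm A A∈))) ⟨
        form (lifts i) (congr T A) (kernel j)
          ≈⟨ form-congr T A (lifts i) (kernel j) ⟩
        form (T ⊗ᵥ lifts i) A (T ⊗ᵥ kernel j)
          ≈⟨ W-iso _ _ A (T[Span-w]⊆W (lifts⊆ i)) (T[Span-w]⊆W (kernel⊆ j)) A∈ ⟩
        0# ∎

    α≤maxNullSum : Invertible T → ∀ {a M} → IsAlpha 𝒜 a → IsMaxNullSum (UpperBlocks s t 𝒜 T) M →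
                   ¬ ¬ (a ℕ.≤ M × a ℕ.≤ s ℕ.+ t)
    α≤maxNullSum (T′ , TT′≈I , _) {a} {M} ((W , W-iso , (b , b∈W , b-ind , _)) , _) (_ , M-max) =
      kernelAdapted s w (⊗ᵥ-independent TT′≈I b-ind) >>= bounds
      where
      w : Fin a → Vec (s ℕ.+ t)
      w k = T′ ⊗ᵥ b k

      T[Span-w]⊆W : ∀ {v} → Span w v → W (T ⊗ᵥ v)
      T[Span-w]⊆W v∈ = Span⊆ (proj₁ W-iso) (λ k → T ⊗ᵥ w k)
        (λ k → IsSubspaceᵥ.resp (proj₁ W-iso) (≈ᵥ-sym (⊗ᵥ-cancelˡ TT′≈I (b k))) (b∈W k)) (⊗ᵥ-Span T v∈)

      bounds : KernelAdapted s w → ¬ ¬ (a ℕ.≤ M × a ℕ.≤ s ℕ.+ t)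
      bounds R = ¬¬-map (λ nullity≤t → a≤M , ≡.subst (ℕ._≤ s ℕ.+ t) rank+nullity (ℕₚ.+-mono-≤ rank≤s nullity≤t))
                        (independent⇒≤ (drop s ∘ kernel) kernel↓-independent)
        where
        open KernelAdapted R
        kernel↓-independent : Independent (drop s ∘ kernel)
        kernel↓-independent = drop-independent s kernel-top kernel-independent

        a≤M : a ℕ.≤ M
        a≤M = ≡.subst (ℕ._≤ M) rank+nullity
          (M-max _ _ rank nullity
                 (Span-isSubspace _ , Span-isSubspace _ , kernelAdapted-orthogonal W-iso w T[Span-w]⊆W R)
                 (Independent⇒HasDim _ lifts-independent) (Independent⇒HasDim _ kernel↓-independent))

open import Data.Nat using (_+_; _∸_; _≤_)

theorem1p7 : ∀ {c ℓ : Level} (F : Field c ℓ) → let open LinAlg F in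
    (s t : ℕ) → 1 ≤ s → 1 ≤ t →
    (𝒜 : Mat (s + t) (s + t) → Set _) → IsSubspaceₘ 𝒜 → (∀ A → 𝒜 A → Alternating A) →
    Bipartite 𝒜 →
    (T : Mat (s + t) (s + t)) → Invertible T → BlockForm s t 𝒜 T →
    (a r : ℕ) → IsAlpha 𝒜 a → IsNcrk (UpperBlocks s t 𝒜 T) r →
    a ≡ (s + t) ∸ r
theorem1p7 F s t _ _ 𝒜 _ _ _ T T-inv blockForm a r α (M , maxNull , r≡n∸M) =
  decidable-stable (a ℕ.≟ s + t ∸ r) (¬¬-map conclude (α≤maxNullSum F 𝒜 T blockForm T-inv α maxNull))
  where
  open ≡.≡-Reasoning

  M≤a : M ≤ a
  M≤a = maxNullSum≤α F 𝒜 T blockForm T-inv α maxNull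

  conclude : a ≤ M × a ≤ s + t → a ≡ s + t ∸ r
  conclude (a≤M , a≤n) = begin
    a                   ≡⟨ ℕₚ.≤-antisym a≤M M≤a ⟩
    M                   ≡⟨ ℕₚ.m∸[m∸n]≡n (ℕₚ.≤-trans M≤a a≤n) ⟨
    s + t ∸ (s + t ∸ M) ≡⟨ ≡.cong (s + t ∸_) r≡n∸M ⟨
    s + t ∸ r           ∎
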